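{- For each \[ (n,k,d)\in\{(14,6,7),\ (15,7,7),\ (17,6,9),\ (17,7,8),\ (19,7,9),\ (20,7,10)\}, \] there exists a Hermitian LCD $[n,k,d]_4$ code.
   Context: Let $\mathbb{F}_4=\{0,1,\omega,\omega^2\}$ be the field of order $4$, where $\omega^2=\omega+1$, and for $x\in\mathbb{F}_4$ let $\overline{x}=x^2$ (conjugation). A (linear) $[n,k]_4$ code is a $k$-dimensional $\mathbb{F}_4$-subspace $C$ of $\mathbb{F}_4^n$. The weight of a vector is the number of its nonzero coordinates, and the minimum weight of $C$ is the smallest weight of a nonzero vector of $C$. An $[n,k,d]_4$ code is an $[n,k]_4$ code with minimum weight $d$. The Hermitian dual of $C$ is $C^{\perp_H}=\{x\in\mathbb{F}_4^n : \sum_{i=1}^n x_i\overline{y_i}=0 \text{ for all } y\in C\}$. The code $C$ is Hermitian linear complementary dual (Hermitian LCD) if $C\cap C^{\perp_H}=\{\mathbf{0}_n\}$. -}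

module Defs where

open import Data.Nat using (ℕ; zero; suc; _+_; _≤_)
open import Data.Fin using (Fin; zero; suc)
open import Data.Product using (Σ; ∃; _×_; _,_)
open import Relation.Binary.PropositionalEquality using (_≡_)
open import Relation.Nullary using (¬_)

data F4 : Set where
  𝟎 𝟏 ω ω² : F4

infixl 6 _⊕_
infixl 7 _⊗_

_⊕_ : F4 → F4 → F4
𝟎  ⊕ y  = y
x  ⊕ 𝟎  = x
𝟏  ⊕ 𝟏  = 𝟎
𝟏  ⊕ ω  = ω²
𝟏  ⊕ ω² = ω
ω  ⊕ 𝟏  = ω²
ω  ⊕ ω  = 𝟎
ω  ⊕ ω² = 𝟏
ω² ⊕ 𝟏  = ω
ω² ⊕ ω  = 𝟏
ω² ⊕ ω² = 𝟎

_⊗_ : F4 → F4 → F4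
𝟎  ⊗ y  = 𝟎
x  ⊗ 𝟎  = 𝟎
𝟏  ⊗ y  = y
x  ⊗ 𝟏  = x
ω  ⊗ ω  = ω²
ω  ⊗ ω² = 𝟏
ω² ⊗ ω  = 𝟏
ω² ⊗ ω² = ω

conj : F4 → F4
conj x = x ⊗ x

Word : ℕ → Set
Word n = Fin n → F4

zeroWord : ∀ {n} → Word n
zeroWord _ = 𝟎

sumF : ∀ n → (Fin n → F4) → F4
sumF zero    f = 𝟎
sumF (suc n) f = f zero ⊕ sumF n (λ i → f (suc i))

⟨_,_⟩H : ∀ {n} → Word n → Word n → F4
⟨_,_⟩H {n} x y = sumF n (λ i → x i ⊗ conj (y i))

isZero : F4 → ℕ
isZero 𝟎 = 0
isZero _ = 1

wt : ∀ {n} → Word n → ℕ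
wt {zero}  x = 0
wt {suc n} x = isZero (x zero) + wt {n} (λ i → x (suc i))

-- A linear [n,k]_4 code, given by a k × n generator matrix whose rows
-- are linearly independent over F4; the code is the row space.
Matrix : ℕ → ℕ → Set
Matrix k n = Fin k → Fin n → F4

encode : ∀ {k n} → Matrix k n → (Fin k → F4) → Word n
encode {k} G m j = sumF k (λ i → m i ⊗ G i j)

LinIndepRows : ∀ {k n} → Matrix k n → Set
LinIndepRows {k} G = ∀ (m : Fin k → F4) → (∀ j → encode G m j ≡ 𝟎) → ∀ i → m i ≡ 𝟎

record LinearCode (n k : ℕ) : Set where
  field
    gen   : Matrix k n
    indep : LinIndepRows gen

open LinearCode public

_∈C_ : ∀ {n k} → Word n → LinearCode n k → Set
_∈C_ {n} {k} x C = ∃ λ (m : Fin k → F4) → ∀ j → x j ≡ encode (gen C) m j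

_∈C⊥H_ : ∀ {n k} → Word n → LinearCode n k → Set
_∈C⊥H_ {n} x C = ∀ (y : Word n) → y ∈C C → ⟨ x , y ⟩H ≡ 𝟎

IsNonzero : ∀ {n} → Word n → Set
IsNonzero x = ¬ (∀ j → x j ≡ 𝟎)

HasMinWeight : ∀ {n k} → LinearCode n k → ℕ → Set
HasMinWeight {n} C d =
  (∃ λ (x : Word n) → x ∈C C × IsNonzero x × wt x ≡ d)
  × (∀ (x : Word n) → x ∈C C → IsNonzero x → d ≤ wt x)

IsHermitianLCD : ∀ {n k} → LinearCode n k → Set
IsHermitianLCD {n} C = ∀ (x : Word n) → x ∈C C → x ∈C⊥H C → ∀ j → x j ≡ 𝟎

ExistsHermLCD : ℕ → ℕ → ℕ → Set
ExistsHermLCD n k d = Σ (LinearCode n k) λ C → HasMinWeight C d × IsHermitianLCD C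

-- The code
-- is Hermitian LCD as soon as its Gram matrix G Ḡᵀ is nonsingular, i.e. every nonzero message m
-- has ⟨mG, Gᵢ⟩ ≠ 0 for some row Gᵢ: a codeword mG orthogonal to the whole code is orthogonal to
-- every row.  Since ⟨mG, Gᵢ⟩ = (m G Ḡᵀ)ᵢ, the codewords of the extended generator [G | G Ḡᵀ]
-- are the pairs (mG, (⟨mG, Gᵢ⟩)ᵢ), and a single run through the 4ᵏ - 1 nonzero messages checks
-- both the weight bound wt (mG) ≥ d and the nonsingularity of the Gram matrix.
module Submission where

open import Defs
open import Level using (0ℓ)
open import Algebra.Bundles using (Semiring)
open import Relation.Binary.PropositionalEquality
  using (_≡_; _≢_; _≗_; refl; sym; trans; cong; cong₂; subst; isEquivalence; module ≡-Reasoning)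
open import Algebra.Structures {A = F4} _≡_
open import Algebra.Definitions {A = F4} _≡_
open import Data.Bool using (Bool; true; _∧_; T)
open import Data.Bool.Properties using (T-∧; T?)
open import Data.Empty using (⊥-elim)
open import Data.Sum using (inj₁; inj₂)
open import Data.Fin using (Fin; zero; suc; _↑ˡ_; _↑ʳ_)
open import Data.Fin.Properties using (all?; any?)
open import Data.Nat using (ℕ; zero; suc; _+_; _≤_; _≤?_)
open import Data.Nat.Properties using (n≮0; 0≢1+n)
open import Data.Product using (∃; _×_; _,_; proj₁; proj₂)
open import Data.Vec as Vec using (Vec; []; _∷_; lookup; zipWith; replicate; tabulate)
open import Data.Vec.Properties as Vecₚ using (lookup-zipWith; lookup-replicate; lookup∘tabulate)
open import Function using (_∘_; _⇔_; Equivalence; mk⇔)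
open import Relation.Binary.Definitions using (DecidableEquality)
open import Relation.Nullary using (Dec; yes; no; ¬?)
import Relation.Nullary.Decidable as Dec
open import Relation.Nullary.Decidable using (from-yes; map′; ⌊_⌋; toWitness; _×-dec_; _⊎-dec_)
open import Relation.Unary using (Decidable)

infix 4 _≟_
_≟_ : DecidableEquality F4
𝟎  ≟ 𝟎  = yes refl
𝟎  ≟ 𝟏  = no λ ()
𝟎  ≟ ω  = no λ ()
𝟎  ≟ ω² = no λ ()
𝟏  ≟ 𝟎  = no λ ()
𝟏  ≟ 𝟏  = yes refl
𝟏  ≟ ω  = no λ ()
𝟏  ≟ ω² = no λ ()
ω  ≟ 𝟎  = no λ ()
ω  ≟ 𝟏  = no λ ()
ω  ≟ ω  = yes refl
ω  ≟ ω² = no λ ()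
ω² ≟ 𝟎  = no λ ()
ω² ≟ 𝟏  = no λ ()
ω² ≟ ω  = no λ ()
ω² ≟ ω² = yes refl

∀? : {P : F4 → Set} → Decidable P → Dec (∀ x → P x)
∀? P? = map′ (λ { (p₀ , p₁ , p₂ , p₃) → λ { 𝟎 → p₀ ; 𝟏 → p₁ ; ω → p₂ ; ω² → p₃ } })
             (λ p → p 𝟎 , p 𝟏 , p ω , p ω²)
             (P? 𝟎 ×-dec P? 𝟏 ×-dec P? ω ×-dec P? ω²)

⊕-assoc : Associative _⊕_
⊕-assoc = from-yes (∀? λ x → ∀? λ y → ∀? λ z → (x ⊕ y) ⊕ z ≟ x ⊕ (y ⊕ z))

⊕-comm : Commutative _⊕_
⊕-comm = from-yes (∀? λ x → ∀? λ y → x ⊕ y ≟ y ⊕ x)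

⊕-identityʳ : RightIdentity 𝟎 _⊕_
⊕-identityʳ = from-yes (∀? λ x → x ⊕ 𝟎 ≟ x)

⊗-assoc : Associative _⊗_
⊗-assoc = from-yes (∀? λ x → ∀? λ y → ∀? λ z → (x ⊗ y) ⊗ z ≟ x ⊗ (y ⊗ z))

⊗-identity : Identity 𝟏 _⊗_
⊗-identity = from-yes (∀? λ x → 𝟏 ⊗ x ≟ x) , from-yes (∀? λ x → x ⊗ 𝟏 ≟ x)

⊗-zeroʳ : RightZero 𝟎 _⊗_
⊗-zeroʳ = from-yes (∀? λ x → x ⊗ 𝟎 ≟ 𝟎)

⊗-distrib-⊕ : _⊗_ DistributesOver _⊕_
⊗-distrib-⊕ = from-yes (∀? λ x → ∀? λ y → ∀? λ z → x ⊗ (y ⊕ z) ≟ x ⊗ y ⊕ x ⊗ z)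
            , from-yes (∀? λ x → ∀? λ y → ∀? λ z → (y ⊕ z) ⊗ x ≟ y ⊗ x ⊕ z ⊗ x)

F4-isSemiring : IsSemiring _⊕_ _⊗_ 𝟎 𝟏
F4-isSemiring = record
  { isSemiringWithoutAnnihilatingZero = record
    { +-isCommutativeMonoid = record
      { isMonoid = record
        { isSemigroup = record
          { isMagma = record { isEquivalence = isEquivalence ; ∙-cong = cong₂ _⊕_ }
          ; assoc = ⊕-assoc }
        ; identity = (λ _ → refl) , ⊕-identityʳ }
      ; comm = ⊕-comm }
    ; *-cong = cong₂ _⊗_
    ; *-assoc = ⊗-assoc
    ; *-identity = ⊗-identity
    ; distrib = ⊗-distrib-⊕ }
  ; zero = (λ _ → refl) , ⊗-zeroʳ }

F4-semiring : Semiring 0ℓ 0ℓ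
F4-semiring = record { isSemiring = F4-isSemiring }

open import Algebra.Properties.Semiring.Sum F4-semiring
  using (sum; sum-cong-≗; sum-replicate-zero; ∑-comm; *-distribˡ-sum; *-distribʳ-sum)

sumF≡sum : ∀ n (f : Fin n → F4) → sumF n f ≡ sum f
sumF≡sum zero    f = refl
sumF≡sum (suc n) f = cong (f zero ⊕_) (sumF≡sum n (f ∘ suc))

sumF-cong : ∀ {n} {f g : Fin n → F4} → f ≗ g → sumF n f ≡ sumF n g
sumF-cong {n} {f} {g} f≗g = trans (sumF≡sum n f) (trans (sum-cong-≗ f≗g) (sym (sumF≡sum n g)))

sumF-zero : ∀ {n} {f : Fin n → F4} → (∀ i → f i ≡ 𝟎) → sumF n f ≡ 𝟎
sumF-zero {n} f≡0 = trans (sumF-cong f≡0) (trans (sumF≡sum n _) (sum-replicate-zero n))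

⟨⟩H-congˡ : ∀ {n} {x x′ : Word n} (y : Word n) → x ≗ x′ → ⟨ x , y ⟩H ≡ ⟨ x′ , y ⟩H
⟨⟩H-congˡ y x≗x′ = sumF-cong (λ j → cong (_⊗ conj (y j)) (x≗x′ j))

⟨encode⟩H : ∀ {k n} (G : Matrix k n) (m : Fin k → F4) (y : Word n) →
            ⟨ encode G m , y ⟩H ≡ sumF k (λ t → m t ⊗ ⟨ G t , y ⟩H)
⟨encode⟩H {k} {n} G m y = begin
  ⟨ encode G m , y ⟩H
    ≡⟨ sumF≡sum n _ ⟩
  sum (λ j → sumF k (λ t → m t ⊗ G t j) ⊗ conj (y j))
    ≡⟨ sum-cong-≗ (λ j → trans (cong (_⊗ conj (y j)) (sumF≡sum k _))
                               (*-distribʳ-sum (conj (y j)) (λ t → m t ⊗ G t j))) ⟩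
  sum (λ j → sum (λ t → (m t ⊗ G t j) ⊗ conj (y j)))
    ≡⟨ ∑-comm (λ j t → (m t ⊗ G t j) ⊗ conj (y j)) ⟩
  sum (λ t → sum (λ j → (m t ⊗ G t j) ⊗ conj (y j)))
    ≡⟨ sum-cong-≗ (λ t → trans (sum-cong-≗ (λ j → ⊗-assoc (m t) (G t j) (conj (y j))))
                               (sym (*-distribˡ-sum (m t) (λ j → G t j ⊗ conj (y j))))) ⟩
  sum (λ t → m t ⊗ sum (λ j → G t j ⊗ conj (y j)))
    ≡⟨ sym (trans (sumF≡sum k _) (sum-cong-≗ (λ t → cong (m t ⊗_) (sumF≡sum n _)))) ⟩
  sumF k (λ t → m t ⊗ ⟨ G t , y ⟩H) ∎
  where open ≡-Reasoning

wt-cong : ∀ {n} {x y : Word n} → x ≗ y → wt x ≡ wt y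
wt-cong {zero}  _   = refl
wt-cong {suc n} x≗y = cong₂ _+_ (cong isZero (x≗y zero)) (wt-cong (x≗y ∘ suc))

wt-zero : ∀ {n} {x : Word n} → (∀ j → x j ≡ 𝟎) → wt x ≡ 0
wt-zero {zero}  _   = refl
wt-zero {suc n} x≡0 rewrite x≡0 zero = wt-zero (x≡0 ∘ suc)

wt≡suc⇒nonzero : ∀ {n d} {x : Word n} → wt x ≡ suc d → IsNonzero x
wt≡suc⇒nonzero wt≡ x≡0 = 0≢1+n (trans (sym (wt-zero x≡0)) wt≡)

encode-zero : ∀ {k n} (G : Matrix k n) {m : Fin k → F4} → (∀ i → m i ≡ 𝟎) → ∀ j → encode G m j ≡ 𝟎
encode-zero G m≡0 j = sumF-zero (λ t → cong (_⊗ G t j) (m≡0 t))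

nonzero-message : ∀ {k n} (G : Matrix k n) {x : Word n} {m : Fin k → F4} →
                  (∀ j → x j ≡ encode G m j) → IsNonzero x → IsNonzero m
nonzero-message G x≡mG x≢0 m≡0 = x≢0 (λ j → trans (x≡mG j) (encode-zero G m≡0 j))

δ : ∀ {k} → Fin k → Fin k → F4
δ zero    zero    = 𝟏
δ zero    (suc _) = 𝟎
δ (suc _) zero    = 𝟎
δ (suc i) (suc t) = δ i t

encode-δ : ∀ {k n} (G : Matrix k n) i j → encode G (δ i) j ≡ G i j
encode-δ {suc k} G zero j =
  trans (cong₂ _⊕_ (proj₁ ⊗-identity (G zero j)) (sumF-zero {k} (λ _ → refl))) (⊕-identityʳ (G zero j))
encode-δ G (suc i) j = encode-δ (G ∘ suc) i j

row∈C : ∀ {n k} (C : LinearCode n k) i → gen C i ∈C C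
row∈C C i = δ i , λ j → sym (encode-δ (gen C) i j)

linIndep : ∀ {k n d} (G : Matrix k n) → (∀ m → IsNonzero m → suc d ≤ wt (encode G m)) →
           LinIndepRows G
linIndep G bound m mG≡0 i with m i ≟ 𝟎
... | yes mᵢ≡0 = mᵢ≡0
... | no  mᵢ≢0 = ⊥-elim (n≮0 (subst (_ ≤_) (wt-zero mG≡0) (bound m (λ m≡0 → mᵢ≢0 (m≡0 i)))))

module _ {n k} (C : LinearCode n k) where

  hasMinWeight : ∀ {d} → (∀ m → IsNonzero m → suc d ≤ wt (encode (gen C) m)) →
                 (∃ λ m → wt (encode (gen C) m) ≡ suc d) → HasMinWeight C (suc d)
  hasMinWeight {d} bound (m₀ , wt≡) =
    (encode (gen C) m₀ , (m₀ , λ _ → refl) , wt≡suc⇒nonzero wt≡ , wt≡) ,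
    λ x (m , x≡mG) x≢0 →
      subst (suc d ≤_) (sym (wt-cong x≡mG)) (bound m (nonzero-message (gen C) x≡mG x≢0))

  isHermitianLCD : (∀ m → IsNonzero m → ∃ λ i → ⟨ encode (gen C) m , gen C i ⟩H ≢ 𝟎) →
                   IsHermitianLCD C
  isHermitianLCD nonsingular x (m , x≡mG) x⊥C with all? (λ j → x j ≟ 𝟎)
  ... | yes x≡0 = x≡0
  ... | no  x≢0 with nonsingular m (nonzero-message (gen C) x≡mG x≢0)
  ...   | i , ⟨mG,Gi⟩≢0 =
    ⊥-elim (⟨mG,Gi⟩≢0 (trans (⟨⟩H-congˡ (gen C i) (sym ∘ x≡mG)) (x⊥C (gen C i) (row∈C C i))))

existsHermLCD : ∀ {k n d} (G : Matrix k n) →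
                (∀ m → IsNonzero m → suc d ≤ wt (encode G m)) →
                (∀ m → IsNonzero m → ∃ λ i → ⟨ encode G m , G i ⟩H ≢ 𝟎) →
                (∃ λ m → wt (encode G m) ≡ suc d) →
                ExistsHermLCD n k (suc d)
existsHermLCD G bound nonsingular witness =
  C , hasMinWeight C bound witness , isHermitianLCD C nonsingular
  where
  C = record { gen = G ; indep = linIndep G bound }

-- Rows and partial combinations are vectors rather than functions, so that each partial
-- combination is computed once and shared by everything enumerated below it.
toMatrix : ∀ {k n} → Vec (Vec F4 n) k → Matrix k n
toMatrix rs t j = lookup (lookup rs t) j

addScaled : ∀ {n} → Vec F4 n → F4 → Vec F4 n → Vec F4 n
addScaled acc c r = zipWith (λ a b → a ⊕ c ⊗ b) acc r

infixl 6 _⊕ᵛ_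
_⊕ᵛ_ : ∀ {n} → Vec F4 n → Word n → Word n
(acc ⊕ᵛ x) j = lookup acc j ⊕ x j

⊕ᵛ-addScaled : ∀ {k n} acc r (rs : Vec (Vec F4 n) k) (m : Fin (suc k) → F4) →
               addScaled acc (m zero) r ⊕ᵛ encode (toMatrix rs) (m ∘ suc) ≗ acc ⊕ᵛ encode (toMatrix (r ∷ rs)) m
⊕ᵛ-addScaled acc r rs m j = trans (cong (_⊕ _) (lookup-zipWith _ j acc r)) (⊕-assoc (lookup acc j) _ _)

module Enumeration {N} (Q : Word N → Set) (Q? : ∀ v → Dec (Q (lookup v))) where

  everyCombination : ∀ {k} → Vec (Vec F4 N) k → Vec F4 N → Bool
  everyCombination []       acc = ⌊ Q? acc ⌋
  everyCombination (r ∷ rs) acc = ⌊ ∀? (λ c → T? (everyCombination rs (addScaled acc c r))) ⌋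

  everyNonzeroCombination : ∀ {k} → Vec (Vec F4 N) k → Vec F4 N → Bool
  everyNonzeroCombination []       acc = true
  everyNonzeroCombination (r ∷ rs) acc =
    everyNonzeroCombination rs acc ∧
    ⌊ ∀? (λ c → c ≟ 𝟎 ⊎-dec T? (everyCombination rs (addScaled acc c r))) ⌋

  module _ (Q-cong : ∀ {x y} → x ≗ y → Q x → Q y) where

    everyCombination-sound : ∀ {k} (rs : Vec (Vec F4 N) k) acc → T (everyCombination rs acc) →
                             ∀ m → Q (acc ⊕ᵛ encode (toMatrix rs) m)
    everyCombination-sound []       acc ok m = Q-cong (λ j → sym (⊕-identityʳ _)) (toWitness ok)
    everyCombination-sound (r ∷ rs) acc ok m =
      Q-cong (⊕ᵛ-addScaled acc r rs m)
             (everyCombination-sound rs (addScaled acc (m zero) r) (toWitness ok (m zero)) (m ∘ suc))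

    everyNonzeroCombination-sound : ∀ {k} (rs : Vec (Vec F4 N) k) acc →
                                    T (everyNonzeroCombination rs acc) →
                                    ∀ m → IsNonzero m → Q (acc ⊕ᵛ encode (toMatrix rs) m)
    everyNonzeroCombination-sound []       acc _  m m≢0 = ⊥-elim (m≢0 λ ())
    everyNonzeroCombination-sound (r ∷ rs) acc ok m m≢0 with Equivalence.to T-∧ ok | m zero ≟ 𝟎
    ... | okₜ , _ | yes m₀≡0 =
      Q-cong (λ j → cong (λ c → lookup acc j ⊕ (c ⊗ lookup r j ⊕ encode (toMatrix rs) (m ∘ suc) j)) (sym m₀≡0))
             (everyNonzeroCombination-sound rs acc okₜ (m ∘ suc)
               (λ mₜ≡0 → m≢0 λ { zero → m₀≡0 ; (suc i) → mₜ≡0 i }))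
    ... | _ , ok₀ | no m₀≢0 with toWitness ok₀ (m zero)
    ...   | inj₁ m₀≡0 = ⊥-elim (m₀≢0 m₀≡0)
    ...   | inj₂ okᵣ  = Q-cong (⊕ᵛ-addScaled acc r rs m)
                               (everyCombination-sound rs (addScaled acc (m zero) r) okᵣ (m ∘ suc))

wtᵛ : ∀ {n} → Vec F4 n → ℕ
wtᵛ xs = Vec.sum (Vec.map isZero xs)

wtᵛ≡wt : ∀ {n} (xs : Vec F4 n) → wtᵛ xs ≡ wt (lookup xs)
wtᵛ≡wt []       = refl
wtᵛ≡wt (x ∷ xs) = cong (isZero x +_) (wtᵛ≡wt xs)

gram : ∀ {k n} → Matrix k n → Matrix k k
gram G t i = ⟨ G t , G i ⟩H

withGram : ∀ {k n} → Matrix k n → Vec (Vec F4 (n + k)) k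
withGram G = tabulate (λ t → tabulate (G t) Vec.++ tabulate (gram G t))

module _ {k n} (G : Matrix k n) (m : Fin k → F4) where

  encode-withGramˡ : ∀ j → encode (toMatrix (withGram G)) m (j ↑ˡ k) ≡ encode G m j
  encode-withGramˡ j = sumF-cong λ t → cong (m t ⊗_) (begin
    lookup (lookup (withGram G) t) (j ↑ˡ k)               ≡⟨ cong (λ r → lookup r (j ↑ˡ k)) (lookup∘tabulate _ t) ⟩
    lookup (tabulate (G t) Vec.++ tabulate (gram G t)) (j ↑ˡ k) ≡⟨ Vecₚ.lookup-++ˡ (tabulate (G t)) _ j ⟩
    lookup (tabulate (G t)) j                              ≡⟨ lookup∘tabulate (G t) j ⟩
    G t j                                                  ∎)
    where open ≡-Reasoning

  encode-withGramʳ : ∀ i → encode (toMatrix (withGram G)) m (n ↑ʳ i) ≡ ⟨ encode G m , G i ⟩H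
  encode-withGramʳ i = trans (sumF-cong λ t → cong (m t ⊗_) (begin
    lookup (lookup (withGram G) t) (n ↑ʳ i)               ≡⟨ cong (λ r → lookup r (n ↑ʳ i)) (lookup∘tabulate _ t) ⟩
    lookup (tabulate (G t) Vec.++ tabulate (gram G t)) (n ↑ʳ i) ≡⟨ Vecₚ.lookup-++ʳ (tabulate (G t)) _ i ⟩
    lookup (tabulate (gram G t)) i                         ≡⟨ lookup∘tabulate (gram G t) i ⟩
    gram G t i                                             ∎))
    (sym (⟨encode⟩H G m (G i)))
    where open ≡-Reasoning

module _ (n k d : ℕ) where

  -- Read on a codeword (mG, m G Ḡᵀ) of the extended generator: wt (mG) ≥ d and m G Ḡᵀ ≠ 0.
  Certified : Word (n + k) → Set
  Certified x = d ≤ wt (x ∘ (_↑ˡ k)) × ∃ λ i → x (n ↑ʳ i) ≢ 𝟎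

  Certified-cong : ∀ {x y} → x ≗ y → Certified x → Certified y
  Certified-cong x≗y (d≤wt , i , xᵢ≢0) =
    subst (d ≤_) (wt-cong (x≗y ∘ (_↑ˡ k))) d≤wt , i , xᵢ≢0 ∘ trans (x≗y (n ↑ʳ i))

  Certified-++ : ∀ (xs : Vec F4 n) ys →
                 (d ≤ wtᵛ xs × ∃ λ i → lookup ys i ≢ 𝟎) ⇔ Certified (lookup (xs Vec.++ ys))
  Certified-++ xs ys = mk⇔
    (λ (d≤wt , i , ≢0) → subst (d ≤_) wt≡ d≤wt , i , ≢0 ∘ trans (sym (Vecₚ.lookup-++ʳ xs ys i)))
    (λ (d≤wt , i , ≢0) → subst (d ≤_) (sym wt≡) d≤wt , i , ≢0 ∘ trans (Vecₚ.lookup-++ʳ xs ys i))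
    where
    wt≡ : wtᵛ xs ≡ wt (lookup (xs Vec.++ ys) ∘ (_↑ˡ k))
    wt≡ = trans (wtᵛ≡wt xs) (wt-cong (sym ∘ Vecₚ.lookup-++ˡ xs ys))

  certified? : ∀ v → Dec (Certified (lookup v))
  certified? v with Vec.splitAt n v
  ... | xs , ys , refl =
    Dec.map (Certified-++ xs ys) (d ≤? wtᵛ xs ×-dec any? (λ i → ¬? (lookup ys i ≟ 𝟎)))

certified-withGram : ∀ {k n d} (G : Matrix k n) m → Certified n k d (encode (toMatrix (withGram G)) m) →
                     d ≤ wt (encode G m) × ∃ λ i → ⟨ encode G m , G i ⟩H ≢ 𝟎
certified-withGram {d = d} G m (d≤wt , i , ≢0) =
  subst (d ≤_) (wt-cong (encode-withGramˡ G m)) d≤wt , i , ≢0 ∘ trans (encode-withGramʳ G m i)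

certificate : ∀ {k n} → ℕ → Vec (Vec F4 n) k → Bool
certificate {k} {n} d Gv =
  everyNonzeroCombination (withGram (toMatrix Gv)) (replicate _ 𝟎)
  where open Enumeration (Certified n k d) (certified? n k d)

fromCertificate : ∀ {k n d} (Gv : Vec (Vec F4 n) k) (m₀ : Vec F4 k) → T (certificate (suc d) Gv) →
                  wt (encode (toMatrix Gv) (lookup m₀)) ≡ suc d → ExistsHermLCD n k (suc d)
fromCertificate {k} {n} {d} Gv m₀ ok wt≡ =
  existsHermLCD G (λ m → proj₁ ∘ certified m) (λ m → proj₂ ∘ certified m) (lookup m₀ , wt≡)
  where
  G = toMatrix Gv
  certified : ∀ m → IsNonzero m → suc d ≤ wt (encode G m) × ∃ λ i → ⟨ encode G m , G i ⟩H ≢ 𝟎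
  certified m m≢0 =
    certified-withGram G m
      (Certified-cong n k (suc d)
        (λ j → cong (_⊕ encode (toMatrix (withGram G)) m j) (lookup-replicate j 𝟎))
        (everyNonzeroCombination-sound (Certified-cong n k (suc d)) (withGram G) (replicate _ 𝟎) ok m m≢0))
    where open Enumeration (Certified n k (suc d)) (certified? n k (suc d))

generator-14-6-7 : Vec (Vec F4 14) 6
generator-14-6-7 =
    (𝟏 ∷ ω² ∷ ω² ∷ ω² ∷ ω ∷ 𝟎 ∷ 𝟎 ∷ ω² ∷ ω ∷ 𝟏 ∷ 𝟏 ∷ ω ∷ 𝟎 ∷ ω² ∷ [])
  ∷ (𝟏 ∷ 𝟎 ∷ ω² ∷ 𝟎 ∷ 𝟎 ∷ ω² ∷ 𝟏 ∷ ω² ∷ ω ∷ ω ∷ ω ∷ 𝟏 ∷ 𝟏 ∷ 𝟏 ∷ [])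
  ∷ (𝟎 ∷ 𝟏 ∷ 𝟏 ∷ 𝟏 ∷ 𝟏 ∷ 𝟎 ∷ 𝟎 ∷ ω ∷ ω² ∷ ω ∷ 𝟏 ∷ ω ∷ 𝟏 ∷ ω² ∷ [])
  ∷ (ω ∷ ω ∷ ω² ∷ ω ∷ 𝟏 ∷ 𝟏 ∷ 𝟏 ∷ ω ∷ 𝟎 ∷ 𝟎 ∷ ω ∷ 𝟎 ∷ ω² ∷ 𝟎 ∷ [])
  ∷ (ω ∷ ω² ∷ 𝟎 ∷ 𝟎 ∷ ω² ∷ ω ∷ ω² ∷ 𝟎 ∷ 𝟏 ∷ 𝟎 ∷ ω² ∷ ω² ∷ 𝟏 ∷ 𝟏 ∷ [])
  ∷ (𝟏 ∷ 𝟎 ∷ ω² ∷ ω ∷ ω² ∷ ω ∷ 𝟎 ∷ 𝟎 ∷ ω² ∷ ω ∷ ω ∷ ω ∷ ω ∷ 𝟏 ∷ [])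
  ∷ []

hermLCD-14-6-7 : ExistsHermLCD 14 6 7
hermLCD-14-6-7 = fromCertificate generator-14-6-7 (𝟎 ∷ 𝟎 ∷ 𝟏 ∷ 𝟏 ∷ ω ∷ 𝟏 ∷ []) _ refl

generator-15-7-7 : Vec (Vec F4 15) 7
generator-15-7-7 =
    (ω² ∷ ω ∷ ω² ∷ ω ∷ 𝟏 ∷ ω² ∷ 𝟏 ∷ 𝟏 ∷ ω ∷ ω² ∷ ω ∷ ω² ∷ 𝟎 ∷ 𝟎 ∷ 𝟎 ∷ [])
  ∷ (𝟎 ∷ 𝟎 ∷ ω² ∷ ω² ∷ ω² ∷ 𝟏 ∷ ω² ∷ 𝟎 ∷ 𝟎 ∷ ω² ∷ ω² ∷ ω ∷ ω ∷ ω ∷ 𝟎 ∷ [])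
  ∷ (ω² ∷ ω ∷ ω² ∷ 𝟎 ∷ 𝟏 ∷ 𝟏 ∷ ω ∷ ω ∷ ω² ∷ ω² ∷ ω² ∷ ω² ∷ ω² ∷ 𝟏 ∷ 𝟎 ∷ [])
  ∷ (𝟎 ∷ 𝟎 ∷ ω² ∷ 𝟎 ∷ 𝟏 ∷ ω ∷ ω ∷ ω² ∷ ω ∷ 𝟎 ∷ 𝟎 ∷ 𝟎 ∷ ω ∷ ω² ∷ 𝟎 ∷ [])
  ∷ (ω ∷ 𝟎 ∷ ω² ∷ 𝟎 ∷ 𝟏 ∷ ω² ∷ ω ∷ ω² ∷ 𝟏 ∷ ω² ∷ ω² ∷ ω² ∷ 𝟏 ∷ 𝟎 ∷ 𝟎 ∷ [])
  ∷ (ω² ∷ 𝟎 ∷ 𝟏 ∷ 𝟏 ∷ ω² ∷ 𝟎 ∷ 𝟎 ∷ 𝟎 ∷ ω ∷ 𝟏 ∷ 𝟎 ∷ ω² ∷ 𝟎 ∷ 𝟎 ∷ 𝟎 ∷ [])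
  ∷ (𝟎 ∷ 𝟎 ∷ 𝟎 ∷ 𝟎 ∷ 𝟎 ∷ ω² ∷ 𝟎 ∷ 𝟏 ∷ ω² ∷ 𝟎 ∷ ω² ∷ 𝟏 ∷ ω ∷ 𝟏 ∷ 𝟏 ∷ [])
  ∷ []

hermLCD-15-7-7 : ExistsHermLCD 15 7 7
hermLCD-15-7-7 = fromCertificate generator-15-7-7 (𝟎 ∷ 𝟎 ∷ 𝟎 ∷ 𝟎 ∷ 𝟎 ∷ 𝟏 ∷ 𝟎 ∷ []) _ refl

generator-17-6-9 : Vec (Vec F4 17) 6
generator-17-6-9 =
    (ω² ∷ ω ∷ 𝟎 ∷ 𝟏 ∷ 𝟏 ∷ 𝟏 ∷ 𝟎 ∷ 𝟎 ∷ ω ∷ 𝟎 ∷ 𝟎 ∷ ω ∷ 𝟎 ∷ ω ∷ 𝟎 ∷ ω ∷ 𝟏 ∷ [])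
  ∷ (𝟎 ∷ 𝟎 ∷ ω ∷ 𝟎 ∷ 𝟎 ∷ 𝟏 ∷ ω² ∷ 𝟏 ∷ 𝟏 ∷ 𝟎 ∷ 𝟏 ∷ 𝟏 ∷ 𝟎 ∷ ω² ∷ 𝟏 ∷ 𝟏 ∷ 𝟎 ∷ [])
  ∷ (ω ∷ 𝟎 ∷ 𝟏 ∷ ω ∷ ω² ∷ ω ∷ 𝟏 ∷ ω ∷ ω ∷ 𝟎 ∷ ω² ∷ ω² ∷ 𝟎 ∷ ω ∷ 𝟏 ∷ 𝟎 ∷ ω ∷ [])
  ∷ (𝟎 ∷ 𝟎 ∷ 𝟏 ∷ 𝟎 ∷ 𝟎 ∷ 𝟏 ∷ 𝟎 ∷ 𝟏 ∷ ω² ∷ 𝟎 ∷ ω ∷ 𝟏 ∷ ω² ∷ 𝟏 ∷ ω ∷ ω² ∷ ω ∷ [])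
  ∷ (ω² ∷ ω² ∷ 𝟎 ∷ 𝟏 ∷ ω ∷ 𝟏 ∷ ω ∷ ω ∷ ω ∷ ω ∷ 𝟎 ∷ 𝟎 ∷ 𝟎 ∷ 𝟏 ∷ 𝟎 ∷ 𝟏 ∷ 𝟎 ∷ [])
  ∷ (ω² ∷ ω ∷ ω² ∷ ω ∷ 𝟎 ∷ 𝟎 ∷ ω² ∷ ω² ∷ 𝟏 ∷ 𝟎 ∷ 𝟎 ∷ 𝟎 ∷ ω ∷ ω² ∷ ω ∷ 𝟎 ∷ ω ∷ [])
  ∷ []

hermLCD-17-6-9 : ExistsHermLCD 17 6 9
hermLCD-17-6-9 = fromCertificate generator-17-6-9 (𝟎 ∷ 𝟎 ∷ 𝟏 ∷ 𝟏 ∷ ω² ∷ 𝟎 ∷ []) _ refl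

generator-17-7-8 : Vec (Vec F4 17) 7
generator-17-7-8 =
    (ω ∷ ω² ∷ 𝟎 ∷ ω ∷ 𝟏 ∷ ω² ∷ ω² ∷ 𝟎 ∷ ω ∷ 𝟏 ∷ ω² ∷ 𝟎 ∷ 𝟎 ∷ 𝟏 ∷ ω² ∷ ω² ∷ 𝟎 ∷ [])
  ∷ (𝟏 ∷ 𝟎 ∷ ω² ∷ ω ∷ 𝟎 ∷ 𝟎 ∷ 𝟏 ∷ 𝟏 ∷ ω ∷ ω ∷ 𝟎 ∷ ω² ∷ ω² ∷ 𝟎 ∷ 𝟎 ∷ ω ∷ 𝟏 ∷ [])
  ∷ (𝟎 ∷ ω ∷ 𝟏 ∷ 𝟏 ∷ ω ∷ ω ∷ 𝟎 ∷ ω ∷ 𝟏 ∷ 𝟎 ∷ ω ∷ ω² ∷ ω² ∷ 𝟎 ∷ 𝟎 ∷ ω² ∷ ω² ∷ [])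
  ∷ (ω ∷ 𝟏 ∷ 𝟏 ∷ 𝟏 ∷ ω ∷ 𝟎 ∷ ω ∷ ω ∷ 𝟏 ∷ ω² ∷ 𝟏 ∷ 𝟎 ∷ ω² ∷ 𝟏 ∷ 𝟎 ∷ 𝟎 ∷ 𝟏 ∷ [])
  ∷ (ω ∷ ω ∷ ω ∷ 𝟏 ∷ 𝟏 ∷ ω² ∷ ω² ∷ 𝟎 ∷ 𝟎 ∷ 𝟎 ∷ ω ∷ 𝟎 ∷ 𝟎 ∷ ω ∷ 𝟎 ∷ ω² ∷ ω² ∷ [])
  ∷ (𝟏 ∷ ω² ∷ ω² ∷ 𝟎 ∷ ω ∷ ω² ∷ 𝟎 ∷ 𝟏 ∷ 𝟎 ∷ ω² ∷ ω ∷ 𝟎 ∷ ω ∷ 𝟎 ∷ ω ∷ ω ∷ 𝟎 ∷ [])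
  ∷ (ω² ∷ 𝟎 ∷ ω ∷ ω ∷ 𝟏 ∷ ω ∷ ω² ∷ 𝟏 ∷ 𝟎 ∷ 𝟎 ∷ ω ∷ 𝟎 ∷ 𝟏 ∷ ω ∷ ω ∷ 𝟎 ∷ 𝟏 ∷ [])
  ∷ []

hermLCD-17-7-8 : ExistsHermLCD 17 7 8
hermLCD-17-7-8 = fromCertificate generator-17-7-8 (𝟎 ∷ 𝟎 ∷ 𝟎 ∷ 𝟏 ∷ 𝟎 ∷ 𝟎 ∷ ω² ∷ []) _ refl

generator-19-7-9 : Vec (Vec F4 19) 7
generator-19-7-9 =
    (𝟏 ∷ 𝟎 ∷ 𝟎 ∷ 𝟎 ∷ 𝟎 ∷ 𝟎 ∷ 𝟎 ∷ ω² ∷ ω ∷ ω² ∷ 𝟏 ∷ ω² ∷ ω ∷ 𝟎 ∷ ω² ∷ 𝟏 ∷ 𝟏 ∷ ω ∷ ω² ∷ [])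
  ∷ (𝟎 ∷ 𝟏 ∷ 𝟎 ∷ 𝟎 ∷ 𝟎 ∷ 𝟎 ∷ 𝟎 ∷ 𝟏 ∷ 𝟎 ∷ 𝟎 ∷ ω² ∷ 𝟏 ∷ ω² ∷ ω² ∷ ω ∷ ω² ∷ 𝟏 ∷ ω ∷ 𝟎 ∷ [])
  ∷ (𝟎 ∷ 𝟎 ∷ 𝟏 ∷ 𝟎 ∷ 𝟎 ∷ 𝟎 ∷ 𝟎 ∷ ω ∷ ω² ∷ ω ∷ 𝟎 ∷ 𝟏 ∷ ω ∷ 𝟎 ∷ 𝟎 ∷ ω² ∷ 𝟎 ∷ ω² ∷ 𝟏 ∷ [])
  ∷ (𝟎 ∷ 𝟎 ∷ 𝟎 ∷ 𝟏 ∷ 𝟎 ∷ 𝟎 ∷ 𝟎 ∷ ω² ∷ ω ∷ ω² ∷ ω² ∷ 𝟏 ∷ 𝟏 ∷ ω² ∷ 𝟏 ∷ 𝟎 ∷ ω ∷ 𝟏 ∷ ω² ∷ [])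
  ∷ (𝟎 ∷ 𝟎 ∷ 𝟎 ∷ 𝟎 ∷ 𝟏 ∷ 𝟎 ∷ 𝟎 ∷ ω² ∷ ω² ∷ 𝟎 ∷ ω ∷ ω ∷ 𝟎 ∷ 𝟎 ∷ ω² ∷ ω ∷ ω² ∷ ω² ∷ ω ∷ [])
  ∷ (𝟎 ∷ 𝟎 ∷ 𝟎 ∷ 𝟎 ∷ 𝟎 ∷ 𝟏 ∷ 𝟎 ∷ 𝟎 ∷ ω² ∷ ω² ∷ 𝟏 ∷ ω ∷ 𝟎 ∷ ω ∷ 𝟎 ∷ 𝟏 ∷ ω ∷ ω² ∷ 𝟏 ∷ [])
  ∷ (𝟎 ∷ 𝟎 ∷ 𝟎 ∷ 𝟎 ∷ 𝟎 ∷ 𝟎 ∷ 𝟏 ∷ 𝟏 ∷ 𝟎 ∷ 𝟎 ∷ ω² ∷ 𝟎 ∷ 𝟎 ∷ ω ∷ ω ∷ ω ∷ ω ∷ 𝟏 ∷ 𝟏 ∷ [])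
  ∷ []

hermLCD-19-7-9 : ExistsHermLCD 19 7 9
hermLCD-19-7-9 = fromCertificate generator-19-7-9 (𝟎 ∷ 𝟎 ∷ 𝟎 ∷ 𝟎 ∷ 𝟎 ∷ 𝟎 ∷ 𝟏 ∷ []) _ refl

generator-20-7-10 : Vec (Vec F4 20) 7
generator-20-7-10 =
    (𝟏 ∷ 𝟎 ∷ ω² ∷ ω ∷ ω² ∷ 𝟎 ∷ 𝟎 ∷ 𝟎 ∷ ω ∷ ω ∷ 𝟎 ∷ ω ∷ ω ∷ 𝟎 ∷ 𝟏 ∷ 𝟏 ∷ ω² ∷ ω ∷ ω ∷ ω ∷ [])
  ∷ (𝟎 ∷ ω² ∷ 𝟎 ∷ ω² ∷ ω ∷ 𝟏 ∷ ω² ∷ ω ∷ 𝟎 ∷ ω ∷ ω² ∷ ω² ∷ ω ∷ ω ∷ 𝟏 ∷ ω ∷ ω ∷ ω ∷ 𝟎 ∷ ω ∷ [])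
  ∷ (ω ∷ ω² ∷ 𝟎 ∷ ω ∷ 𝟎 ∷ ω ∷ ω ∷ 𝟏 ∷ ω² ∷ ω ∷ ω ∷ ω ∷ ω ∷ 𝟏 ∷ ω² ∷ 𝟎 ∷ 𝟏 ∷ 𝟎 ∷ 𝟎 ∷ 𝟎 ∷ [])
  ∷ (ω² ∷ ω ∷ 𝟎 ∷ ω² ∷ 𝟏 ∷ 𝟏 ∷ ω ∷ 𝟏 ∷ ω² ∷ ω² ∷ 𝟏 ∷ 𝟏 ∷ ω ∷ ω² ∷ ω² ∷ ω² ∷ ω² ∷ ω² ∷ ω² ∷ 𝟏 ∷ [])
  ∷ (𝟎 ∷ ω² ∷ ω² ∷ ω² ∷ 𝟏 ∷ 𝟏 ∷ 𝟎 ∷ 𝟏 ∷ ω ∷ ω² ∷ ω ∷ 𝟏 ∷ 𝟏 ∷ 𝟎 ∷ 𝟏 ∷ ω ∷ ω ∷ ω ∷ ω ∷ ω² ∷ [])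
  ∷ (ω ∷ 𝟏 ∷ ω² ∷ 𝟎 ∷ 𝟎 ∷ ω ∷ 𝟎 ∷ ω ∷ 𝟏 ∷ 𝟎 ∷ 𝟎 ∷ 𝟎 ∷ ω ∷ ω ∷ ω² ∷ 𝟎 ∷ 𝟏 ∷ 𝟏 ∷ 𝟎 ∷ ω ∷ [])
  ∷ (𝟎 ∷ ω ∷ ω ∷ ω ∷ ω² ∷ ω² ∷ 𝟎 ∷ 𝟎 ∷ ω² ∷ ω ∷ 𝟎 ∷ ω² ∷ ω ∷ 𝟏 ∷ ω ∷ ω ∷ ω ∷ 𝟎 ∷ ω² ∷ ω ∷ [])
  ∷ []

hermLCD-20-7-10 : ExistsHermLCD 20 7 10
hermLCD-20-7-10 = fromCertificate generator-20-7-10 (𝟎 ∷ 𝟎 ∷ 𝟎 ∷ 𝟎 ∷ 𝟏 ∷ 𝟎 ∷ ω ∷ []) _ refl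

proposition2p1 : ExistsHermLCD 14 6 7 × ExistsHermLCD 15 7 7 × ExistsHermLCD 17 6 9 × ExistsHermLCD 17 7 8 × ExistsHermLCD 19 7 9 × ExistsHermLCD 20 7 10
proposition2p1 =
  hermLCD-14-6-7 , hermLCD-15-7-7 , hermLCD-17-6-9 , hermLCD-17-7-8 , hermLCD-19-7-9 , hermLCD-20-7-10
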